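{- For every $d\in\mathbb{N}$, $$\sum_{i=0}^{d+1}\psi_{i,d+1-i}\,MC(i,d+1-i) + \sum_{i=0}^{d}\psi_{i,d-i}\,MC(i,d-i) = \frac{2^{d+1}(-1)^{d+1}(d+1)}{(d+2)(d+3)}.$$
   Context: $\mathbb{N}=\{0,1,2,\dots\}$. Lascoux coefficients $\psi_I$ are defined for finite sets $I$ of non-negative integers by $\psi_\emptyset=1$, $\psi_{\{i\}}=2^i$, and for $j_0<j_1<\dots<j_r$ ($r\ge 1$): $(r+1)\psi_{\{j_0,\dots,j_r\}} - 2\sum_{l}\psi_{\{j_0,\dots,j_l-1,\dots,j_r\}}$ equals $\psi_{\{j_1,\dots,j_r\}}$ if $j_0=0$ and $0$ otherwise, where the sum runs over those $l\in\{1,\dots,r\}$ with $j_l-1>j_{l-1}$. For $a,b\in\mathbb{N}$ define $\psi_{a,b}=\psi_{\{a,b\}}$ if $a<b$, $\psi_{a,a}=0$, and $\psi_{a,b}=-\psi_{b,a}$ if $a>b$. For non-negative integers $i,j$, $MC(i,j) = \frac{(j-i)(-1)^{i+j}}{(i+1)(j+1)\binom{i+j+2}{i+1}}$. -}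

module Defs where

open import Data.Nat as ℕ using (ℕ; zero; suc; _≤_; _<_; z≤n; s≤s; NonZero; _∸_)
open import Data.Nat.Properties as ℕP using (≤-trans; m≤m+n)
open import Data.Nat.Combinatorics using (_C_; nCk≡nC[n∸k]; nCn≡1; nCk+nC[k+1]≡[n+1]C[k+1])
open import Data.Integer as ℤ using (ℤ; +_; _⊖_)
open import Data.Rational as ℚ using (ℚ; 0ℚ; 1ℚ; _/_)
open import Relation.Binary.PropositionalEquality using (_≡_; refl; sym; trans; subst)
open import Relation.Binary.Definitions using (tri<; tri≈; tri>)

Σ : ℕ → (ℕ → ℚ) → ℚ
Σ zero    f = 0ℚ
Σ (suc n) f = Σ n f ℚ.+ f n

ψ₁ : ℕ → ℚ
ψ₁ i = (+ (2 ℕ.^ i)) / 1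

-- Right-hand side of the defining recursion for I = {j₀ < j₁} (r = 1):
-- ψ_{j₁} if j₀ = 0, and 0 otherwise.
rhs₂ : ℕ → ℕ → ℚ
rhs₂ zero    j₁ = ψ₁ j₁
rhs₂ (suc _) j₁ = 0ℚ

-- ψG j₀ k = ψ_{ {j₀ , j₁} } with j₁ = j₀ + 1 + k  (so j₀ < j₁).
-- The defining recursion with r = 1, the sum running over l ∈ {0,1} with the
-- convention j₋₁ = -1, reads
--   2 ψ_{j₀,j₁} - 2 ( [j₀ - 1 ≥ 0] ψ_{j₀-1,j₁} + [j₁ - 1 > j₀] ψ_{j₀,j₁-1} ) = rhs₂ j₀ j₁,
-- i.e. ψ_{j₀,j₁} = ½ (rhs₂ j₀ j₁ + 2 (…)).
two : ℚ
two = + 2 / 1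

ψG : ℕ → ℕ → ℚ
-- j₀ = 0, j₁ = 1 : no term in the sum
ψG zero    zero    = ℚ.½ ℚ.* rhs₂ zero 1
-- j₀ = 0, j₁ = k + 2 : only the l = 1 term ψ_{0, k+1}
ψG zero    (suc k) = ℚ.½ ℚ.* (rhs₂ zero (suc (suc k)) ℚ.+ two ℚ.* ψG zero k)
-- j₀ = a + 1, j₁ = a + 2 : only the l = 0 term ψ_{a, a+2}
ψG (suc a) zero    = ℚ.½ ℚ.* (rhs₂ (suc a) (suc (suc a)) ℚ.+ two ℚ.* ψG a 1)
-- j₀ = a + 1, j₁ = a + k + 3 : terms ψ_{a, a+k+3} and ψ_{a+1, a+k+2}
ψG (suc a) (suc k) = ℚ.½ ℚ.* (rhs₂ (suc a) (suc (suc (suc (a ℕ.+ k))))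
                        ℚ.+ two ℚ.* (ψG a (suc (suc k)) ℚ.+ ψG (suc a) k))

ψ : ℕ → ℕ → ℚ
ψ a b with ℕP.<-cmp a b
... | tri< _ _ _ = ψG a (b ∸ suc a)
... | tri≈ _ _ _ = 0ℚ
... | tri> _ _ _ = ℚ.- ψG b (a ∸ suc b)

C-pos : ∀ n k → k ≤ n → 0 < n C k
C-pos n zero z≤n rewrite nCk≡nC[n∸k] {n = n} (z≤n {n}) | nCn≡1 n = s≤s z≤n
C-pos (suc n) (suc k) (s≤s k≤n)
  rewrite sym (nCk+nC[k+1]≡[n+1]C[k+1] n k) =
  ≤-trans (C-pos n k k≤n) (m≤m+n (n C k) (n C suc k))

binom-nonZero : ∀ i j → NonZero ((suc (suc (i ℕ.+ j))) C (suc i))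
binom-nonZero i j = ℕ.>-nonZero (C-pos (suc (suc (i ℕ.+ j))) (suc i)
  (s≤s (ℕP.≤-trans (ℕP.m≤m+n i j) (ℕP.n≤1+n (i ℕ.+ j)))))

MC : ℕ → ℕ → ℚ
MC i j = ((j ⊖ i) ℤ.* (ℤ.-1ℤ ℤ.^ (i ℕ.+ j))) / (suc i ℕ.* suc j ℕ.* (suc (suc (i ℕ.+ j)) C suc i))
  where instance
    _ : NonZero (suc i ℕ.* suc j ℕ.* (suc (suc (i ℕ.+ j)) C suc i))
    _ = ℕP.m*n≢0 (suc i ℕ.* suc j) _ {{_}} {{binom-nonZero i j}}

-- Pascal's rule shows that ψ_{a,b} = Σ_{a<m≤b} C(a+b, m), read antisymmetrically, satisfies
-- the defining recursion; hence ψ_{i,n-i+1} - ψ_{i+1,n-i} = C(n+2, i+1). On the other side,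
-- MC(i, n-i) = (-1)^n/(n+2) · (1/C(n+1,i) - 1/C(n+1,i+1)). Summation by parts therefore turns
-- Σ_i ψ_{i,n-i} MC(i,n-i) into (-1)^n/(n+2) · (ψ_{0,n} - ψ_{n,0} - n) = (-1)^n (2^{n+1} - n - 2)/(n+2),
-- and the theorem adds the instances n = d+1 and n = d.

module Submission where

open import Defs
open import Level using (0ℓ)
open import Data.Nat using (ℕ; zero; suc; NonZero; _<_; _≤_; z≤n; s≤s; s≤s⁻¹; _∸_)
import Data.Nat as ℕ
import Data.Nat.Properties as ℕP
open import Data.Nat.Combinatorics using (_C_; nCk≡nC[n∸k]; nCn≡1; nC1≡n; nCk+nC[k+1]≡[n+1]C[k+1])
open import Data.Nat.Combinatorics.Specification using (k>n⇒nCk≡0)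
open import Data.Nat.Tactic.RingSolver using () renaming (solve-∀ to ℕ-solve-∀)
open import Data.Integer using (ℤ; +_; -1ℤ; _⊖_; _^_) renaming (_*_ to _*ℤ_)
import Data.Integer as ℤ
import Data.Integer.Properties as ℤP
open import Data.Integer.Tactic.RingSolver using () renaming (solve-∀ to ℤ-solve-∀)
open import Data.Rational using (ℚ; 0ℚ; 1ℚ; _+_; _*_; -_; _-_; _/_; ½; toℚᵘ)
open import Data.Rational.Properties as ℚP using (+-*-commutativeRing; _≟_)
open import Data.Rational.Unnormalised as ℚᵘ using (mkℚᵘ; *≡*)
import Data.Rational.Unnormalised.Properties as ℚᵘP
open import Data.Product using (_,_)
open import Relation.Binary.Definitions using (tri<; tri≈; tri>)
open import Relation.Binary.PropositionalEquality
open import Relation.Nullary.Decidable.Core using (dec⇒maybe)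
import Tactic.RingSolver.Core.AlmostCommutativeRing as ACR
open import Tactic.RingSolver using (solve-∀)

ℚ-ring : ACR.AlmostCommutativeRing 0ℓ 0ℓ
ℚ-ring = ACR.fromCommutativeRing +-*-commutativeRing (λ x → dec⇒maybe (0ℚ ≟ x))

fromℤ : ℤ → ℚ
fromℤ a = a / 1

fromℕ : ℕ → ℚ
fromℕ n = fromℤ (+ n)

toℚᵘ-/ : ∀ a m .{{_ : NonZero m}} → toℚᵘ (a / m) ℚᵘ.≃ mkℚᵘ a (ℕ.pred m)
toℚᵘ-/ a (suc k) = ℚP.toℚᵘ-fromℚᵘ (mkℚᵘ a k)

fromℤ-homo-+ : ∀ a b → fromℤ (a ℤ.+ b) ≡ fromℤ a + fromℤ b
fromℤ-homo-+ a b = ℚP.toℚᵘ-injective (begin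
  toℚᵘ (fromℤ (a ℤ.+ b))             ≈⟨ toℚᵘ-/ (a ℤ.+ b) 1 ⟩
  mkℚᵘ (a ℤ.+ b) 0                   ≈⟨ *≡* (cross a b) ⟩
  mkℚᵘ a 0 ℚᵘ.+ mkℚᵘ b 0             ≈⟨ ℚᵘP.+-cong (toℚᵘ-/ a 1) (toℚᵘ-/ b 1) ⟨
  toℚᵘ (fromℤ a) ℚᵘ.+ toℚᵘ (fromℤ b) ≈⟨ ℚP.toℚᵘ-homo-+ (fromℤ a) (fromℤ b) ⟨
  toℚᵘ (fromℤ a + fromℤ b)           ∎)
  where
  open ℚᵘP.≃-Reasoning
  cross : ∀ a b → (a ℤ.+ b) *ℤ + 1 ≡ (a *ℤ + 1 ℤ.+ b *ℤ + 1) *ℤ + 1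
  cross = ℤ-solve-∀

fromℤ-homo-* : ∀ a b → fromℤ (a *ℤ b) ≡ fromℤ a * fromℤ b
fromℤ-homo-* a b = ℚP.toℚᵘ-injective (begin
  toℚᵘ (fromℤ (a *ℤ b))             ≈⟨ toℚᵘ-/ (a *ℤ b) 1 ⟩
  mkℚᵘ (a *ℤ b) 0                   ≈⟨ *≡* refl ⟩
  mkℚᵘ a 0 ℚᵘ.* mkℚᵘ b 0             ≈⟨ ℚᵘP.*-cong (toℚᵘ-/ a 1) (toℚᵘ-/ b 1) ⟨
  toℚᵘ (fromℤ a) ℚᵘ.* toℚᵘ (fromℤ b) ≈⟨ ℚP.toℚᵘ-homo-* (fromℤ a) (fromℤ b) ⟨
  toℚᵘ (fromℤ a * fromℤ b)           ∎)
  where open ℚᵘP.≃-Reasoning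

fromℤ-homo-‿- : ∀ a → fromℤ (ℤ.- a) ≡ - fromℤ a
fromℤ-homo-‿- a = ℚP.toℚᵘ-injective (begin
  toℚᵘ (fromℤ (ℤ.- a)) ≈⟨ toℚᵘ-/ (ℤ.- a) 1 ⟩
  mkℚᵘ (ℤ.- a) 0       ≈⟨ ℚᵘP.-‿cong (toℚᵘ-/ a 1) ⟨
  ℚᵘ.- toℚᵘ (fromℤ a)  ≈⟨ ℚP.toℚᵘ-homo‿- (fromℤ a) ⟨
  toℚᵘ (- fromℤ a)     ∎)
  where open ℚᵘP.≃-Reasoning

fromℕ-homo-+ : ∀ m n → fromℕ (m ℕ.+ n) ≡ fromℕ m + fromℕ n
fromℕ-homo-+ m n = trans (cong fromℤ (ℤP.pos-+ m n)) (fromℤ-homo-+ (+ m) (+ n))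

fromℕ-homo-* : ∀ m n → fromℕ (m ℕ.* n) ≡ fromℕ m * fromℕ n
fromℕ-homo-* m n = trans (cong fromℤ (ℤP.pos-* m n)) (fromℤ-homo-* (+ m) (+ n))

fromℤ-⊖ : ∀ m n → fromℤ (m ⊖ n) ≡ fromℕ m - fromℕ n
fromℤ-⊖ m n = begin
  fromℤ (m ⊖ n)                 ≡⟨ cong fromℤ (ℤP.m-n≡m⊖n m n) ⟨
  fromℤ (+ m ℤ.+ ℤ.- + n)        ≡⟨ fromℤ-homo-+ (+ m) (ℤ.- + n) ⟩
  fromℕ m + fromℤ (ℤ.- + n)      ≡⟨ cong (λ x → fromℕ m + x) (fromℤ-homo-‿- (+ n)) ⟩
  fromℕ m - fromℕ n              ∎
  where open ≡-Reasoning

fromℤ-[-1]*ℤ : ∀ e → fromℤ (-1ℤ *ℤ e) ≡ - fromℤ e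
fromℤ-[-1]*ℤ e = trans (cong fromℤ (ℤP.-1*i≡-i e)) (fromℤ-homo-‿- e)

fromℕ-*-≡ : ∀ a b c d → a ℕ.* b ≡ c ℕ.* d → fromℕ a * fromℕ b ≡ fromℕ c * fromℕ d
fromℕ-*-≡ a b c d eq =
  trans (sym (fromℕ-homo-* a b)) (trans (cong fromℕ eq) (fromℕ-homo-* c d))

[a/m]*m≡a : ∀ a m .{{_ : NonZero m}} → (a / m) * fromℕ m ≡ fromℤ a
[a/m]*m≡a a m@(suc k) = ℚP.toℚᵘ-injective (begin
  toℚᵘ ((a / m) * fromℕ m)             ≈⟨ ℚP.toℚᵘ-homo-* (a / m) (fromℕ m) ⟩
  toℚᵘ (a / m) ℚᵘ.* toℚᵘ (fromℕ m)     ≈⟨ ℚᵘP.*-cong (toℚᵘ-/ a m) (toℚᵘ-/ (+ m) 1) ⟩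
  mkℚᵘ a k ℚᵘ.* mkℚᵘ (+ m) 0           ≈⟨ *≡* (cross a (+ m)) ⟩
  mkℚᵘ a 0                             ≈⟨ toℚᵘ-/ a 1 ⟨
  toℚᵘ (fromℤ a)                       ∎)
  where
  open ℚᵘP.≃-Reasoning
  cross : ∀ a m → (a *ℤ m) *ℤ + 1 ≡ a *ℤ (m *ℤ + 1)
  cross = ℤ-solve-∀

x*m≡a⇒x≡a/m : ∀ {x} a m .{{_ : NonZero m}} → x * fromℕ m ≡ fromℤ a → x ≡ a / m
x*m≡a⇒x≡a/m {x} a m x*m≡a = trans (≡a*1/m x*m≡a) (sym (≡a*1/m ([a/m]*m≡a a m)))
  where
  open ≡-Reasoning
  ≡a*1/m : ∀ {y} → y * fromℕ m ≡ fromℤ a → y ≡ fromℤ a * (+ 1 / m)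
  ≡a*1/m {y} y*m≡a = begin
    y                               ≡⟨ ℚP.*-identityʳ y ⟨
    y * 1ℚ                          ≡⟨ cong (y *_) ([a/m]*m≡a (+ 1) m) ⟨
    y * ((+ 1 / m) * fromℕ m)       ≡⟨ swap y (+ 1 / m) (fromℕ m) ⟩
    (y * fromℕ m) * (+ 1 / m)       ≡⟨ cong (_* (+ 1 / m)) y*m≡a ⟩
    fromℤ a * (+ 1 / m)             ∎
    where
    swap : ∀ y u v → y * (u * v) ≡ (y * v) * u
    swap = solve-∀ ℚ-ring

-- recip 0 = 0 is a junk value; recip is only applied to positive binomial coefficients.
recip : ℕ → ℚ
recip zero    = 0ℚ
recip (suc m) = + 1 / suc m

fromℕ*recip≡1 : ∀ {m} → 0 < m → fromℕ m * recip m ≡ 1ℚ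
fromℕ*recip≡1 {suc m} _ = trans (ℚP.*-comm (fromℕ (suc m)) (recip (suc m))) ([a/m]*m≡a (+ 1) (suc m))

Σ-cong< : ∀ n {f g : ℕ → ℚ} → (∀ i → i < n → f i ≡ g i) → Σ n f ≡ Σ n g
Σ-cong< zero    f≡g = refl
Σ-cong< (suc n) f≡g =
  cong₂ _+_ (Σ-cong< n (λ i i<n → f≡g i (ℕP.m<n⇒m<1+n i<n))) (f≡g n (ℕP.n<1+n n))

Σ-*ˡ : ∀ n c f → Σ n (λ i → c * f i) ≡ c * Σ n f
Σ-*ˡ zero    c f = sym (ℚP.*-zeroʳ c)
Σ-*ˡ (suc n) c f =
  trans (cong (_+ c * f n) (Σ-*ˡ n c f)) (sym (ℚP.*-distribˡ-+ c (Σ n f) (f n)))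

Σ-const : ∀ n x → Σ n (λ _ → x) ≡ fromℕ n * x
Σ-const zero    x = sym (ℚP.*-zeroˡ x)
Σ-const (suc n) x = begin
  Σ n (λ _ → x) + x         ≡⟨ cong (_+ x) (Σ-const n x) ⟩
  fromℕ n * x + x           ≡⟨ distrib (fromℕ n) x ⟩
  (1ℚ + fromℕ n) * x        ≡⟨ cong (_* x) (fromℕ-homo-+ 1 n) ⟨
  fromℕ (suc n) * x         ∎
  where
  open ≡-Reasoning
  distrib : ∀ y x → y * x + x ≡ (1ℚ + y) * x
  distrib = solve-∀ ℚ-ring

Σ-by-parts : ∀ n (a b : ℕ → ℚ) →
  Σ (suc n) (λ i → a i * (b i - b (suc i)))
    ≡ a 0 * b 0 - a n * b (suc n) + Σ n (λ k → (a (suc k) - a k) * b (suc k))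
Σ-by-parts zero    a b = expand (a 0) (b 0) (b 1)
  where
  expand : ∀ a₀ b₀ b₁ → 0ℚ + a₀ * (b₀ - b₁) ≡ a₀ * b₀ - a₀ * b₁ + 0ℚ
  expand = solve-∀ ℚ-ring
Σ-by-parts (suc n) a b = begin
  Σ (suc n) (λ i → a i * (b i - b (suc i))) + a (suc n) * (b (suc n) - b (suc (suc n)))
    ≡⟨ cong (_+ a (suc n) * (b (suc n) - b (suc (suc n)))) (Σ-by-parts n a b) ⟩
  a 0 * b 0 - a n * b (suc n) + S + a (suc n) * (b (suc n) - b (suc (suc n)))
    ≡⟨ shift (a 0 * b 0) (a n) (a (suc n)) (b (suc n)) (b (suc (suc n))) S ⟩
  a 0 * b 0 - a (suc n) * b (suc (suc n)) + (S + (a (suc n) - a n) * b (suc n)) ∎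
  where
  open ≡-Reasoning
  S = Σ n (λ k → (a (suc k) - a k) * b (suc k))
  shift : ∀ c aₙ aₙ₊₁ bₙ₊₁ bₙ₊₂ S →
    c - aₙ * bₙ₊₁ + S + aₙ₊₁ * (bₙ₊₁ - bₙ₊₂) ≡ c - aₙ₊₁ * bₙ₊₂ + (S + (aₙ₊₁ - aₙ) * bₙ₊₁)
  shift = solve-∀ ℚ-ring

C-sym : ∀ {m n o} → m ℕ.+ n ≡ o → o C m ≡ o C n
C-sym {m} {n} refl =
  trans (nCk≡nC[n∸k] (ℕP.m≤m+n m n)) (cong ((m ℕ.+ n) C_) (ℕP.m+n∸m≡n m n))

[1+k]*[1+n]C[1+k]≡[1+n]*nCk : ∀ n k → suc k ℕ.* (suc n C suc k) ≡ suc n ℕ.* (n C k)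
[1+k]*[1+n]C[1+k]≡[1+n]*nCk n zero =
  trans (ℕP.+-identityʳ (suc n C 1)) (trans (nC1≡n (suc n)) (sym (ℕP.*-identityʳ (suc n))))
[1+k]*[1+n]C[1+k]≡[1+n]*nCk zero (suc k) =
  trans (cong (suc (suc k) ℕ.*_) (k>n⇒nCk≡0 {1} {suc (suc k)} (s≤s (s≤s z≤n)))) (ℕP.*-zeroʳ (suc (suc k)))
[1+k]*[1+n]C[1+k]≡[1+n]*nCk (suc n) (suc k) = begin
  suc (suc k) ℕ.* (suc (suc n) C suc (suc k))
    ≡⟨ cong (suc (suc k) ℕ.*_) (sym (nCk+nC[k+1]≡[n+1]C[k+1] (suc n) (suc k))) ⟩
  suc (suc k) ℕ.* (A ℕ.+ B)
    ≡⟨ split k A B ⟩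
  suc k ℕ.* A ℕ.+ A ℕ.+ suc (suc k) ℕ.* B
    ≡⟨ cong₂ (λ x y → x ℕ.+ A ℕ.+ y)
             ([1+k]*[1+n]C[1+k]≡[1+n]*nCk n k) ([1+k]*[1+n]C[1+k]≡[1+n]*nCk n (suc k)) ⟩
  suc n ℕ.* (n C k) ℕ.+ A ℕ.+ suc n ℕ.* (n C suc k)
    ≡⟨ merge n (n C k) A (n C suc k) ⟩
  suc n ℕ.* (n C k ℕ.+ n C suc k) ℕ.+ A
    ≡⟨ cong (λ x → suc n ℕ.* x ℕ.+ A) (nCk+nC[k+1]≡[n+1]C[k+1] n k) ⟩
  suc n ℕ.* A ℕ.+ A
    ≡⟨ ℕP.+-comm (suc n ℕ.* A) A ⟩
  suc (suc n) ℕ.* A ∎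
  where
  open ≡-Reasoning
  A = suc n C suc k
  B = suc n C suc (suc k)
  split : ∀ k A B → suc (suc k) ℕ.* (A ℕ.+ B) ≡ suc k ℕ.* A ℕ.+ A ℕ.+ suc (suc k) ℕ.* B
  split = ℕ-solve-∀
  merge : ∀ n x A y → suc n ℕ.* x ℕ.+ A ℕ.+ suc n ℕ.* y ≡ suc n ℕ.* (x ℕ.+ y) ℕ.+ A
  merge = ℕ-solve-∀

[1+j]*[1+i+j]Ci≡[1+i]*[1+i+j]C[1+i] : ∀ i j →
  suc j ℕ.* (suc (i ℕ.+ j) C i) ≡ suc i ℕ.* (suc (i ℕ.+ j) C suc i)
[1+j]*[1+i+j]Ci≡[1+i]*[1+i+j]C[1+i] i j = begin
  suc j ℕ.* (suc n C i)     ≡⟨ cong (suc j ℕ.*_) (C-sym {i} {suc j} (ℕP.+-suc i j)) ⟩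
  suc j ℕ.* (suc n C suc j) ≡⟨ [1+k]*[1+n]C[1+k]≡[1+n]*nCk n j ⟩
  suc n ℕ.* (n C j)         ≡⟨ cong (suc n ℕ.*_) (C-sym {i} {j} refl) ⟨
  suc n ℕ.* (n C i)         ≡⟨ [1+k]*[1+n]C[1+k]≡[1+n]*nCk n i ⟨
  suc i ℕ.* (suc n C suc i) ∎
  where
  open ≡-Reasoning
  n = i ℕ.+ j

binomialPrefix : ℕ → ℕ → ℚ
binomialPrefix n t = Σ t (λ m → fromℕ (n C m))

binomialPrefix-pascal : ∀ n t →
  binomialPrefix (suc n) (suc t) ≡ binomialPrefix n t + binomialPrefix n (suc t)
binomialPrefix-pascal n zero    = refl
binomialPrefix-pascal n (suc t) = begin
  binomialPrefix (suc n) (suc t) + fromℕ (suc n C suc t)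
    ≡⟨ cong₂ _+_ (binomialPrefix-pascal n t)
                 (trans (cong fromℕ (sym (nCk+nC[k+1]≡[n+1]C[k+1] n t))) (fromℕ-homo-+ (n C t) (n C suc t))) ⟩
  (binomialPrefix n t + binomialPrefix n (suc t)) + (fromℕ (n C t) + fromℕ (n C suc t))
    ≡⟨ interchange (binomialPrefix n t) (binomialPrefix n (suc t)) (fromℕ (n C t)) (fromℕ (n C suc t)) ⟩
  binomialPrefix n (suc t) + binomialPrefix n (suc (suc t)) ∎
  where
  open ≡-Reasoning
  interchange : ∀ x y u v → (x + y) + (u + v) ≡ (x + u) + (y + v)
  interchange = solve-∀ ℚ-ring

binomialPrefix[n,1+n]≡2^n : ∀ n → binomialPrefix n (suc n) ≡ fromℕ (2 ℕ.^ n)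
binomialPrefix[n,1+n]≡2^n zero    = refl
binomialPrefix[n,1+n]≡2^n (suc n) = begin
  binomialPrefix (suc n) (suc (suc n))
    ≡⟨ binomialPrefix-pascal n (suc n) ⟩
  binomialPrefix n (suc n) + (binomialPrefix n (suc n) + fromℕ (n C suc n))
    ≡⟨ cong₂ (λ x c → x + (x + fromℕ c)) (binomialPrefix[n,1+n]≡2^n n) (k>n⇒nCk≡0 (ℕP.n<1+n n)) ⟩
  fromℕ (2 ℕ.^ n) + (fromℕ (2 ℕ.^ n) + 0ℚ)
    ≡⟨ double (fromℕ (2 ℕ.^ n)) ⟩
  fromℕ 2 * fromℕ (2 ℕ.^ n)
    ≡⟨ fromℕ-homo-* 2 (2 ℕ.^ n) ⟨
  fromℕ (2 ℕ.^ suc n) ∎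
  where
  open ≡-Reasoning
  double : ∀ x → x + (x + 0ℚ) ≡ fromℕ 2 * x
  double = solve-∀ ℚ-ring

ψ′ : ℕ → ℕ → ℚ
ψ′ a b = binomialPrefix (a ℕ.+ b) (suc b) - binomialPrefix (a ℕ.+ b) (suc a)

ψ′-diag : ∀ a → ψ′ a a ≡ 0ℚ
ψ′-diag a = ℚP.+-inverseʳ (binomialPrefix (a ℕ.+ a) (suc a))

ψ′-antisym : ∀ a b → ψ′ b a ≡ - ψ′ a b
ψ′-antisym a b = begin
  binomialPrefix (b ℕ.+ a) (suc a) - binomialPrefix (b ℕ.+ a) (suc b)
    ≡⟨ cong (λ n → binomialPrefix n (suc a) - binomialPrefix n (suc b)) (ℕP.+-comm b a) ⟩
  binomialPrefix (a ℕ.+ b) (suc a) - binomialPrefix (a ℕ.+ b) (suc b)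
    ≡⟨ flip (binomialPrefix (a ℕ.+ b) (suc a)) (binomialPrefix (a ℕ.+ b) (suc b)) ⟩
  - ψ′ a b ∎
  where
  open ≡-Reasoning
  flip : ∀ x y → x - y ≡ - (y - x)
  flip = solve-∀ ℚ-ring

ψ′-pascal : ∀ a b → ψ′ (suc a) (suc b) ≡ ψ′ a (suc b) + ψ′ (suc a) b
ψ′-pascal a b = begin
  P (suc n) (suc (suc b)) - P (suc n) (suc (suc a))
    ≡⟨ cong₂ _-_ (binomialPrefix-pascal n (suc b)) (binomialPrefix-pascal n (suc a)) ⟩
  (P n (suc b) + P n (suc (suc b))) - (P n (suc a) + P n (suc (suc a)))
    ≡⟨ regroup (P n (suc b)) (P n (suc (suc b))) (P n (suc a)) (P n (suc (suc a))) ⟩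
  ψ′ a (suc b) + (P n (suc b) - P n (suc (suc a)))
    ≡⟨ cong (λ m → ψ′ a (suc b) + (P m (suc b) - P m (suc (suc a)))) (ℕP.+-suc a b) ⟩
  ψ′ a (suc b) + ψ′ (suc a) b ∎
  where
  open ≡-Reasoning
  P = binomialPrefix
  n = a ℕ.+ suc b
  regroup : ∀ x y u v → (x + y) - (u + v) ≡ (y - u) + (x - v)
  regroup = solve-∀ ℚ-ring

ψ′-zero : ∀ n → ψ′ 0 n ≡ fromℕ (2 ℕ.^ n) - 1ℚ
ψ′-zero n = cong (_- 1ℚ) (binomialPrefix[n,1+n]≡2^n n)

ψ′-zero-suc : ∀ n → ψ′ 0 (suc n) ≡ fromℕ (2 ℕ.^ n) + ψ′ 0 n
ψ′-zero-suc n = begin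
  ψ′ 0 (suc n)                          ≡⟨ ψ′-zero (suc n) ⟩
  fromℕ (2 ℕ.^ suc n) - 1ℚ                ≡⟨ cong (_- 1ℚ) (fromℕ-homo-* 2 (2 ℕ.^ n)) ⟩
  fromℕ 2 * fromℕ (2 ℕ.^ n) - 1ℚ          ≡⟨ split (fromℕ (2 ℕ.^ n)) ⟩
  fromℕ (2 ℕ.^ n) + (fromℕ (2 ℕ.^ n) - 1ℚ)  ≡⟨ cong (λ y → fromℕ (2 ℕ.^ n) + y) (ψ′-zero n) ⟨
  fromℕ (2 ℕ.^ n) + ψ′ 0 n                ∎
  where
  open ≡-Reasoning
  split : ∀ x → fromℕ 2 * x - 1ℚ ≡ x + (x - 1ℚ)
  split = solve-∀ ℚ-ring

½*[0+two*x]≡x : ∀ x → ½ * (0ℚ + two * x) ≡ x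
½*[0+two*x]≡x = solve-∀ ℚ-ring

ψG≡ψ′ : ∀ a k → ψG a k ≡ ψ′ a (suc (a ℕ.+ k))
ψG≡ψ′ zero    zero    = refl
ψG≡ψ′ zero    (suc k) = begin
  ½ * (fromℕ (2 ℕ.* 2 ℕ.^ suc k) + two * ψG 0 k)
    ≡⟨ cong₂ (λ x y → ½ * (x + two * y)) (fromℕ-homo-* 2 (2 ℕ.^ suc k)) (ψG≡ψ′ 0 k) ⟩
  ½ * (two * fromℕ (2 ℕ.^ suc k) + two * ψ′ 0 (suc k))
    ≡⟨ halve (fromℕ (2 ℕ.^ suc k)) (ψ′ 0 (suc k)) ⟩
  fromℕ (2 ℕ.^ suc k) + ψ′ 0 (suc k)
    ≡⟨ ψ′-zero-suc (suc k) ⟨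
  ψ′ 0 (suc (suc k)) ∎
  where
  open ≡-Reasoning
  halve : ∀ x y → ½ * (two * x + two * y) ≡ x + y
  halve = solve-∀ ℚ-ring
ψG≡ψ′ (suc a) zero    = begin
  ½ * (0ℚ + two * ψG a 1)                 ≡⟨ ½*[0+two*x]≡x (ψG a 1) ⟩
  ψG a 1                                  ≡⟨ ψG≡ψ′ a 1 ⟩
  ψ′ a (suc (a ℕ.+ 1))                    ≡⟨ cong (λ m → ψ′ a (suc m)) (ℕP.+-comm a 1) ⟩
  ψ′ a (suc (suc a))                      ≡⟨ ℚP.+-identityʳ _ ⟨
  ψ′ a (suc (suc a)) + 0ℚ                 ≡⟨ cong (λ y → ψ′ a (suc (suc a)) + y) (ψ′-diag (suc a)) ⟨
  ψ′ a (suc (suc a)) + ψ′ (suc a) (suc a) ≡⟨ ψ′-pascal a (suc a) ⟨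
  ψ′ (suc a) (suc (suc a))                ≡⟨ cong (λ m → ψ′ (suc a) (suc (suc m))) (ℕP.+-identityʳ a) ⟨
  ψ′ (suc a) (suc (suc (a ℕ.+ 0)))        ∎
  where open ≡-Reasoning
ψG≡ψ′ (suc a) (suc k) = begin
  ½ * (0ℚ + two * (ψG a (suc (suc k)) + ψG (suc a) k))
    ≡⟨ ½*[0+two*x]≡x (ψG a (suc (suc k)) + ψG (suc a) k) ⟩
  ψG a (suc (suc k)) + ψG (suc a) k
    ≡⟨ cong₂ _+_ (ψG≡ψ′ a (suc (suc k))) (ψG≡ψ′ (suc a) k) ⟩
  ψ′ a (suc (a ℕ.+ suc (suc k))) + ψ′ (suc a) (suc (suc (a ℕ.+ k)))
    ≡⟨ cong₂ (λ m m′ → ψ′ a (suc m) + ψ′ (suc a) (suc m′)) (ℕP.+-suc a (suc k)) (sym (ℕP.+-suc a k)) ⟩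
  ψ′ a (suc (suc (a ℕ.+ suc k))) + ψ′ (suc a) (suc (a ℕ.+ suc k))
    ≡⟨ ψ′-pascal a (suc (a ℕ.+ suc k)) ⟨
  ψ′ (suc a) (suc (suc (a ℕ.+ suc k))) ∎
  where open ≡-Reasoning

ψ≡ψ′ : ∀ a b → ψ a b ≡ ψ′ a b
ψ≡ψ′ a b with ℕP.<-cmp a b
... | tri< a<b _ _ = trans (ψG≡ψ′ a (b ∸ suc a)) (cong (ψ′ a) (ℕP.m+[n∸m]≡n a<b))
... | tri≈ _ refl _ = sym (ψ′-diag a)
... | tri> _ _ b<a = trans (cong -_ (ψG≡ψ′ b (a ∸ suc b)))
                           (trans (cong (λ m → - ψ′ b m) (ℕP.m+[n∸m]≡n b<a)) (sym (ψ′-antisym b a)))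

ψ-step : ∀ a b → ψ a (suc b) - ψ (suc a) b ≡ fromℕ (suc (suc (a ℕ.+ b)) C suc a)
ψ-step a b = begin
  ψ a (suc b) - ψ (suc a) b
    ≡⟨ cong₂ _-_ (ψ≡ψ′ a (suc b)) (ψ≡ψ′ (suc a) b) ⟩
  ψ′ a (suc b) - ψ′ (suc a) b
    ≡⟨ cong (λ m → (P m (suc (suc b)) - P m (suc a)) - ψ′ (suc a) b) (ℕP.+-suc a b) ⟩
  (P n (suc (suc b)) - P n (suc a)) - (P n (suc b) - P n (suc (suc a)))
    ≡⟨ telescope (P n (suc b)) (P n (suc a)) (fromℕ (n C suc b)) (fromℕ (n C suc a)) ⟩
  fromℕ (n C suc b) + fromℕ (n C suc a)
    ≡⟨ cong (λ c → fromℕ c + fromℕ (n C suc a)) (C-sym {a} {suc b} (ℕP.+-suc a b)) ⟨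
  fromℕ (n C a) + fromℕ (n C suc a)
    ≡⟨ fromℕ-homo-+ (n C a) (n C suc a) ⟨
  fromℕ (n C a ℕ.+ n C suc a)
    ≡⟨ cong fromℕ (nCk+nC[k+1]≡[n+1]C[k+1] n a) ⟩
  fromℕ (suc n C suc a) ∎
  where
  open ≡-Reasoning
  P = binomialPrefix
  n = suc (a ℕ.+ b)
  telescope : ∀ x y u v → ((x + u) - y) - (x - (y + v)) ≡ u + v
  telescope = solve-∀ ℚ-ring

κ : ℕ → ℚ
κ n = (-1ℤ ^ n) / suc (suc n)

κ[n]*[2+n]≡[-1]^n : ∀ n → κ n * fromℕ (suc (suc n)) ≡ fromℤ (-1ℤ ^ n)
κ[n]*[2+n]≡[-1]^n n = [a/m]*m≡a (-1ℤ ^ n) (suc (suc n))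

reciprocal-difference : ∀ k N e I J P Q R p q →
  k * N ≡ e → P * p ≡ 1ℚ → Q * q ≡ 1ℚ → J * P ≡ I * Q → I * R ≡ N * P →
  k * (p - q) * (I * J * R) ≡ e * (J - I)
reciprocal-difference k N e I J P Q R p q kN≡e Pp≡1 Qq≡1 JP≡IQ IR≡NP = begin
  k * (p - q) * (I * J * R)          ≡⟨ regroup₁ k p q I J R ⟩
  k * J * (p - q) * (I * R)          ≡⟨ cong (λ x → k * J * (p - q) * x) IR≡NP ⟩
  k * J * (p - q) * (N * P)          ≡⟨ regroup₂ k N J P p q ⟩
  k * N * (J * (P * p) - J * P * q)  ≡⟨ cong₂ (λ x y → x * (J * y - J * P * q)) kN≡e Pp≡1 ⟩
  e * (J * 1ℚ - J * P * q)           ≡⟨ cong (λ x → e * (J * 1ℚ - x * q)) JP≡IQ ⟩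
  e * (J * 1ℚ - I * Q * q)           ≡⟨ regroup₃ e J I Q q ⟩
  e * (J - I * (Q * q))              ≡⟨ cong (λ x → e * (J - I * x)) Qq≡1 ⟩
  e * (J - I * 1ℚ)                   ≡⟨ cong (λ x → e * (J - x)) (ℚP.*-identityʳ I) ⟩
  e * (J - I)                        ∎
  where
  open ≡-Reasoning
  regroup₁ : ∀ k p q I J R → k * (p - q) * (I * J * R) ≡ k * J * (p - q) * (I * R)
  regroup₁ = solve-∀ ℚ-ring
  regroup₂ : ∀ k N J P p q → k * J * (p - q) * (N * P) ≡ k * N * (J * (P * p) - J * P * q)
  regroup₂ = solve-∀ ℚ-ring
  regroup₃ : ∀ e J I Q q → e * (J * 1ℚ - I * Q * q) ≡ e * (J - I * (Q * q))
  regroup₃ = solve-∀ ℚ-ring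

MC≡κ*Δrecip : ∀ i j →
  MC i j ≡ κ (i ℕ.+ j) * (recip (suc (i ℕ.+ j) C i) - recip (suc (i ℕ.+ j) C suc i))
MC≡κ*Δrecip i j = sym (x*m≡a⇒x≡a/m ((j ⊖ i) *ℤ (-1ℤ ^ n)) (suc i ℕ.* suc j ℕ.* R) {{nonZero}} (begin
  κ n * (recip P - recip Q) * fromℕ (suc i ℕ.* suc j ℕ.* R)
    ≡⟨ cong (λ x → κ n * (recip P - recip Q) * x)
            (trans (fromℕ-homo-* (suc i ℕ.* suc j) R) (cong (_* fromℕ R) (fromℕ-homo-* (suc i) (suc j)))) ⟩
  κ n * (recip P - recip Q) * (fromℕ (suc i) * fromℕ (suc j) * fromℕ R)
    ≡⟨ reciprocal-difference (κ n) (fromℕ (suc (suc n))) (fromℤ (-1ℤ ^ n)) (fromℕ (suc i)) (fromℕ (suc j))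
                             (fromℕ P) (fromℕ Q) (fromℕ R) (recip P) (recip Q)
                             (κ[n]*[2+n]≡[-1]^n n) (fromℕ*recip≡1 P>0) (fromℕ*recip≡1 Q>0) JP≡IQ IR≡NP ⟩
  fromℤ (-1ℤ ^ n) * (fromℕ (suc j) - fromℕ (suc i))
    ≡⟨ cong (λ x → fromℤ (-1ℤ ^ n) * x) (fromℤ-⊖ (suc j) (suc i)) ⟨
  fromℤ (-1ℤ ^ n) * fromℤ (suc j ⊖ suc i)
    ≡⟨ ℚP.*-comm (fromℤ (-1ℤ ^ n)) (fromℤ (suc j ⊖ suc i)) ⟩
  fromℤ (suc j ⊖ suc i) * fromℤ (-1ℤ ^ n)
    ≡⟨ cong (λ x → fromℤ x * fromℤ (-1ℤ ^ n)) (ℤP.[1+m]⊖[1+n]≡m⊖n j i) ⟩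
  fromℤ (j ⊖ i) * fromℤ (-1ℤ ^ n)
    ≡⟨ fromℤ-homo-* (j ⊖ i) (-1ℤ ^ n) ⟨
  fromℤ ((j ⊖ i) *ℤ (-1ℤ ^ n)) ∎))
  where
  open ≡-Reasoning
  n = i ℕ.+ j
  P = suc n C i
  Q = suc n C suc i
  R = suc (suc n) C suc i
  nonZero : NonZero (suc i ℕ.* suc j ℕ.* R)
  nonZero = ℕP.m*n≢0 (suc i ℕ.* suc j) R {{_}} {{binom-nonZero i j}}
  P>0 : 0 < P
  P>0 = C-pos (suc n) i (ℕP.m≤n⇒m≤1+n (ℕP.m≤m+n i j))
  Q>0 : 0 < Q
  Q>0 = C-pos (suc n) (suc i) (s≤s (ℕP.m≤m+n i j))
  JP≡IQ : fromℕ (suc j) * fromℕ P ≡ fromℕ (suc i) * fromℕ Q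
  JP≡IQ = fromℕ-*-≡ (suc j) P (suc i) Q ([1+j]*[1+i+j]Ci≡[1+i]*[1+i+j]C[1+i] i j)
  IR≡NP : fromℕ (suc i) * fromℕ R ≡ fromℕ (suc (suc n)) * fromℕ P
  IR≡NP = fromℕ-*-≡ (suc i) R (suc (suc n)) P ([1+k]*[1+n]C[1+k]≡[1+n]*nCk (suc n) i)

Δψ*recip≡-1 : ∀ {n k} → k < n →
  (ψ (suc k) (n ∸ suc k) - ψ k (n ∸ k)) * recip (suc n C suc k) ≡ - 1ℚ
Δψ*recip≡-1 {k = k} k<n with ℕP.m≤n⇒∃[o]m+o≡n k<n
... | d , refl = begin
  (ψ (suc k) (k ℕ.+ d ∸ k) - ψ k (suc (k ℕ.+ d) ∸ k)) * recip c
    ≡⟨ cong₂ (λ x y → (ψ (suc k) x - ψ k y) * recip c) (ℕP.m+n∸m≡n k d)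
             (trans (cong (_∸ k) (sym (ℕP.+-suc k d))) (ℕP.m+n∸m≡n k (suc d))) ⟩
  (ψ (suc k) d - ψ k (suc d)) * recip c
    ≡⟨ cong (_* recip c) (trans (flip (ψ (suc k) d) (ψ k (suc d))) (cong -_ (ψ-step k d))) ⟩
  - fromℕ c * recip c
    ≡⟨ ℚP.neg-distribˡ-* (fromℕ c) (recip c) ⟨
  - (fromℕ c * recip c)
    ≡⟨ cong -_ (fromℕ*recip≡1 c>0) ⟩
  - 1ℚ ∎
  where
  open ≡-Reasoning
  c = suc (suc (k ℕ.+ d)) C suc k
  c>0 : 0 < c
  c>0 = C-pos (suc (suc (k ℕ.+ d))) (suc k) (s≤s (ℕP.m≤n⇒m≤1+n (ℕP.m≤m+n k d)))
  flip : ∀ x y → x - y ≡ - (y - x)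
  flip = solve-∀ ℚ-ring

ψ-boundary : ∀ n → ψ 0 n - ψ n 0 + Σ n (λ _ → - 1ℚ) ≡ fromℕ (2 ℕ.^ suc n) - fromℕ (suc (suc n))
ψ-boundary n = begin
  ψ 0 n - ψ n 0 + Σ n (λ _ → - 1ℚ)
    ≡⟨ cong₂ (λ y z → y - z + Σ n (λ _ → - 1ℚ)) (ψ≡ψ′ 0 n) (ψ≡ψ′ n 0) ⟩
  ψ′ 0 n - ψ′ n 0 + Σ n (λ _ → - 1ℚ)
    ≡⟨ cong₂ (λ y z → ψ′ 0 n - y + z) (ψ′-antisym 0 n) (Σ-const n (- 1ℚ)) ⟩
  ψ′ 0 n - (- ψ′ 0 n) + fromℕ n * - 1ℚ
    ≡⟨ cong (λ y → y - (- y) + fromℕ n * - 1ℚ) (ψ′-zero n) ⟩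
  (x - 1ℚ) - (- (x - 1ℚ)) + fromℕ n * - 1ℚ
    ≡⟨ collect x (fromℕ n) ⟩
  fromℕ 2 * x - (fromℕ 2 + fromℕ n)
    ≡⟨ cong₂ _-_ (fromℕ-homo-* 2 (2 ℕ.^ n)) (fromℕ-homo-+ 2 n) ⟨
  fromℕ (2 ℕ.^ suc n) - fromℕ (suc (suc n)) ∎
  where
  open ≡-Reasoning
  x = fromℕ (2 ℕ.^ n)
  collect : ∀ x m → (x - 1ℚ) - (- (x - 1ℚ)) + m * - 1ℚ ≡ fromℕ 2 * x - (fromℕ 2 + m)
  collect = solve-∀ ℚ-ring

Σψ*MC : ∀ n → Σ (suc n) (λ i → ψ i (n ∸ i) * MC i (n ∸ i))
             ≡ κ n * (fromℕ (2 ℕ.^ suc n) - fromℕ (suc (suc n)))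
Σψ*MC n = begin
  Σ (suc n) (λ i → a i * MC i (n ∸ i))
    ≡⟨ Σ-cong< (suc n) (λ i i<1+n → trans (cong (a i *_) (MC-at (s≤s⁻¹ i<1+n))) (rotate (a i) (κ n) _)) ⟩
  Σ (suc n) (λ i → κ n * (a i * (b i - b (suc i))))
    ≡⟨ Σ-*ˡ (suc n) (κ n) (λ i → a i * (b i - b (suc i))) ⟩
  κ n * Σ (suc n) (λ i → a i * (b i - b (suc i)))
    ≡⟨ cong (κ n *_) (Σ-by-parts n a b) ⟩
  κ n * (a 0 * b 0 - a n * b (suc n) + Σ n (λ k → (a (suc k) - a k) * b (suc k)))
    ≡⟨ cong (κ n *_) (cong₂ _+_ (cong₂ _-_ (ℚP.*-identityʳ (ψ 0 n)) last) (Σ-cong< n (λ _ → Δψ*recip≡-1))) ⟩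
  κ n * (ψ 0 n - ψ n 0 + Σ n (λ _ → - 1ℚ))
    ≡⟨ cong (κ n *_) (ψ-boundary n) ⟩
  κ n * (fromℕ (2 ℕ.^ suc n) - fromℕ (suc (suc n))) ∎
  where
  open ≡-Reasoning
  a b : ℕ → ℚ
  a i = ψ i (n ∸ i)
  b i = recip (suc n C i)
  MC-at : ∀ {i} → i ≤ n → MC i (n ∸ i) ≡ κ n * (b i - b (suc i))
  MC-at {i} i≤n = trans (MC≡κ*Δrecip i (n ∸ i))
    (cong (λ m → κ m * (recip (suc m C i) - recip (suc m C suc i))) (ℕP.m+[n∸m]≡n i≤n))
  rotate : ∀ x k y → x * (k * y) ≡ k * (x * y)
  rotate = solve-∀ ℚ-ring
  last : a n * b (suc n) ≡ ψ n 0
  last = trans (cong₂ (λ m c → ψ n m * recip c) (ℕP.n∸n≡0 n) (nCn≡1 (suc n))) (ℚP.*-identityʳ (ψ n 0))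

κ-consecutive-identity : ∀ k₁ k₀ e x D →
  k₁ * (fromℕ 3 + D) ≡ - e → k₀ * (fromℕ 2 + D) ≡ e →
  (k₁ * (fromℕ 2 * x - (fromℕ 3 + D)) + k₀ * (x - (fromℕ 2 + D))) * ((fromℕ 2 + D) * (fromℕ 3 + D))
    ≡ x * (- e) * (1ℚ + D)
κ-consecutive-identity k₁ k₀ e x D k₁B≡-e k₀A≡e = begin
  (k₁ * (fromℕ 2 * x - B) + k₀ * (x - A)) * (A * B)
    ≡⟨ regroup k₁ k₀ x A B ⟩
  k₁ * B * ((fromℕ 2 * x - B) * A) + k₀ * A * ((x - A) * B)
    ≡⟨ cong₂ (λ y z → y * ((fromℕ 2 * x - B) * A) + z * ((x - A) * B)) k₁B≡-e k₀A≡e ⟩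
  - e * ((fromℕ 2 * x - B) * A) + e * ((x - A) * B)
    ≡⟨ cancel e x D ⟩
  x * (- e) * (1ℚ + D) ∎
  where
  open ≡-Reasoning
  A = fromℕ 2 + D
  B = fromℕ 3 + D
  regroup : ∀ k₁ k₀ x A B →
    (k₁ * (fromℕ 2 * x - B) + k₀ * (x - A)) * (A * B)
      ≡ k₁ * B * ((fromℕ 2 * x - B) * A) + k₀ * A * ((x - A) * B)
  regroup = solve-∀ ℚ-ring
  cancel : ∀ e x D →
    - e * ((fromℕ 2 * x - (fromℕ 3 + D)) * (fromℕ 2 + D)) + e * ((x - (fromℕ 2 + D)) * (fromℕ 3 + D))
      ≡ x * (- e) * (1ℚ + D)
  cancel = solve-∀ ℚ-ring

κ-consecutive-sum : ∀ d →
  κ (suc d) * (fromℕ (2 ℕ.^ suc (suc d)) - fromℕ (3 ℕ.+ d)) + κ d * (fromℕ (2 ℕ.^ suc d) - fromℕ (2 ℕ.+ d))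
    ≡ ((+ (2 ℕ.^ suc d) *ℤ (-1ℤ ^ suc d)) *ℤ + suc d) / (suc (suc d) ℕ.* suc (suc (suc d)))
κ-consecutive-sum d = x*m≡a⇒x≡a/m ((+ x *ℤ (-1ℤ *ℤ e)) *ℤ + suc d) (suc (suc d) ℕ.* suc (suc (suc d))) (begin
  (κ (suc d) * (fromℕ (2 ℕ.* x) - fromℕ (3 ℕ.+ d)) + κ d * (fromℕ x - fromℕ (2 ℕ.+ d)))
    * fromℕ ((2 ℕ.+ d) ℕ.* (3 ℕ.+ d))
    ≡⟨ cong₂ (λ y z → (κ (suc d) * (y - fromℕ (3 ℕ.+ d)) + κ d * (fromℕ x - fromℕ (2 ℕ.+ d))) * z)
             (fromℕ-homo-* 2 x) (fromℕ-homo-* (2 ℕ.+ d) (3 ℕ.+ d)) ⟩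
  (κ (suc d) * (fromℕ 2 * fromℕ x - N₃) + κ d * (fromℕ x - N₂)) * (N₂ * N₃)
    ≡⟨ cong₂ (λ y z → (κ (suc d) * (fromℕ 2 * fromℕ x - z) + κ d * (fromℕ x - y)) * (y * z))
             (fromℕ-homo-+ 2 d) (fromℕ-homo-+ 3 d) ⟩
  (κ (suc d) * (fromℕ 2 * fromℕ x - (fromℕ 3 + fromℕ d)) + κ d * (fromℕ x - (fromℕ 2 + fromℕ d)))
    * ((fromℕ 2 + fromℕ d) * (fromℕ 3 + fromℕ d))
    ≡⟨ κ-consecutive-identity (κ (suc d)) (κ d) (fromℤ e) (fromℕ x) (fromℕ d)
         (trans (cong (κ (suc d) *_) (sym (fromℕ-homo-+ 3 d)))
                (trans (κ[n]*[2+n]≡[-1]^n (suc d)) (fromℤ-[-1]*ℤ e)))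
         (trans (cong (κ d *_) (sym (fromℕ-homo-+ 2 d))) (κ[n]*[2+n]≡[-1]^n d)) ⟩
  fromℕ x * (- fromℤ e) * (1ℚ + fromℕ d)
    ≡⟨ cong₂ (λ y z → fromℕ x * y * z) (fromℤ-[-1]*ℤ e) (fromℕ-homo-+ 1 d) ⟨
  fromℕ x * fromℤ (-1ℤ *ℤ e) * fromℕ (suc d)
    ≡⟨ cong (_* fromℕ (suc d)) (fromℤ-homo-* (+ x) (-1ℤ *ℤ e)) ⟨
  fromℤ (+ x *ℤ (-1ℤ *ℤ e)) * fromℕ (suc d)
    ≡⟨ fromℤ-homo-* (+ x *ℤ (-1ℤ *ℤ e)) (+ suc d) ⟨
  fromℤ ((+ x *ℤ (-1ℤ *ℤ e)) *ℤ + suc d) ∎)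
  where
  open ≡-Reasoning
  x = 2 ℕ.^ suc d
  e = -1ℤ ^ d
  N₂ = fromℕ (2 ℕ.+ d)
  N₃ = fromℕ (3 ℕ.+ d)

proposition2p10 : (d : ℕ) →
    Σ (suc (suc d)) (λ i → ψ i (suc d ∸ i) * MC i (suc d ∸ i))
      + Σ (suc d) (λ i → ψ i (d ∸ i) * MC i (d ∸ i))
      ≡ ((+ (2 Data.Nat.^ suc d) *ℤ (-1ℤ ^ suc d)) *ℤ + suc d) / (suc (suc d) Data.Nat.* suc (suc (suc d)))
proposition2p10 d = trans (cong₂ _+_ (Σψ*MC (suc d)) (Σψ*MC d)) (κ-consecutive-sum d)
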